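{- Let $k,l$ be positive integers. Let $G=(V,E)$ be a graph on more than $k$ vertices such that every vertex subset $S\subseteq V$ with $|S|=k$ satisfies $|N_G(S)|\ge l$. Then $G$ contains a path of length $l$.
   Context: For a vertex set $S$, $N_G(S)=\{v\in V\setminus S: v \text{ has a neighbor in } S\}$ denotes the external neighborhood of $S$. Path lengths are measured in edges. -}

module Defs where

open import Data.Nat using (ℕ; suc)
open import Data.Bool using (Bool; true; false; _∧_; not)
open import Data.Fin using (Fin)
open import Data.Fin.Subset using (Subset)
open import Data.Vec using (Vec; tabulate; lookup)
open import Data.List using (List; allFin)
open import Data.Bool.ListAction using (any)
open import Data.Fin using (inject₁; suc)
open import Relation.Binary.PropositionalEquality using (_≡_)
open import Function.Definitions using (Injective)

record Graph (n : ℕ) : Set where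
  field
    adj   : Fin n → Fin n → Bool
    sym   : ∀ u v → adj u v ≡ adj v u
    irrefl : ∀ v → adj v v ≡ false

open Graph public

isIn : ∀ {n} → Subset n → Fin n → Bool
isIn S v = lookup S v

N : ∀ {n} → Graph n → Subset n → Subset n
N G S = tabulate λ v → not (isIn S v) ∧ any (λ u → isIn S u ∧ adj G u v) (allFin _)

record Path {n : ℕ} (G : Graph n) (l : ℕ) : Set where
  field
    vert     : Fin (suc l) → Fin n
    distinct : Injective _≡_ _≡_ vert
    edges    : ∀ (i : Fin l) → adj G (vert (inject₁ i)) (vert (suc i)) ≡ true

-- Depth-first search from every vertex, keeping a set F of finished vertices, a stack (a path ending
-- at the vertex being explored) and the still unvisited vertices. No finished vertex is adjacent to
-- an unvisited one, so N(F) lies on the stack. When the top of a stack of m + 1 vertices is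
-- finished, N(F) lies in the other m vertices; as long as m < l, the hypothesis then keeps |F| < k.
-- So either the stack reaches l + 1 vertices, giving the path, or every vertex gets finished with
-- fewer than k < n vertices, which is absurd.
module Submission where

open import Defs hiding (sym)
open import Data.Bool using (true; false)
open import Data.Bool.Properties using (T-≡; T-not-≡; T-∧; not-¬)
open import Data.Empty using (⊥-elim)
open import Data.Fin using (Fin; zero; suc; inject₁)
open import Data.Fin.Subset using (Subset; ∣_∣; _∈_; _∉_; _⊆_; _∪_; ⁅_⁆; ⊥; ⊤; inside; outside)
open import Data.Fin.Subset.Properties
  using (_∈?_; ∉⊥; x∈⁅x⁆; x∈⁅y⁆⇒x≡y; x∈p∪q⁺; x∈p∪q⁻; q⊆p∪q; ∪-identityˡ; ⊆-refl; ⊆-trans;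
         p⊆q⇒∣p∣≤∣q∣; ∣p∣≤∣x∷p∣; ∣⊥∣≡0; ∣⊤∣≡n)
open import Data.List using ([]; _∷_; allFin)
open import Data.List.Membership.Propositional.Properties using (∈-allFin)
open import Data.List.Relation.Unary.All using (All; []; _∷_) renaming (lookup to All-lookup)
open import Data.List.Relation.Unary.Any using (satisfied)
open import Data.List.Relation.Unary.Any.Properties using (any⁻)
open import Data.Nat using (ℕ; zero; suc; _+_; _≤_; _<_; _≥_; s≤s; NonZero; >-nonZero⁻¹)
open import Data.Nat.Properties
  using (≤-trans; ≤-reflexive; ≤∧≢⇒<; <⇒≱; <-asym; ≤-<-trans; m≤n+m; +-suc; +-identityʳ)
open import Data.Product using (∃; _×_; _,_)
open import Data.Sum using (_⊎_; inj₁; inj₂; [_,_]; map₁; map₂)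
open import Data.Vec using (_∷_)
open import Data.Vec.Properties using ([]=⇒lookup; lookup⇒[]=; lookup∘tabulate)
import Data.Vec.Functional as Vector
open import Function using (_∘_; id)
open import Function.Bundles using (module Equivalence)
open import Function.Definitions using (Injective)
open import Relation.Binary.PropositionalEquality using (_≡_; _≢_; refl; sym; trans; cong; subst)
open import Relation.Nullary using (yes; no)

∣⁅x⁆∪p∣≤1+∣p∣ : ∀ {n} (x : Fin n) (p : Subset n) → ∣ ⁅ x ⁆ ∪ p ∣ ≤ suc ∣ p ∣
∣⁅x⁆∪p∣≤1+∣p∣ zero    (s ∷ p)       =
  s≤s (≤-trans (≤-reflexive (cong ∣_∣ (∪-identityˡ p))) (∣p∣≤∣x∷p∣ s p))
∣⁅x⁆∪p∣≤1+∣p∣ (suc x) (inside ∷ p)  = s≤s (∣⁅x⁆∪p∣≤1+∣p∣ x p)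
∣⁅x⁆∪p∣≤1+∣p∣ (suc x) (outside ∷ p) = ∣⁅x⁆∪p∣≤1+∣p∣ x p

image : ∀ {m n} → (Fin m → Fin n) → Subset n
image {zero}  f = ⊥
image {suc m} f = ⁅ f zero ⁆ ∪ image (f ∘ suc)

f∈image : ∀ {m n} (f : Fin m → Fin n) i → f i ∈ image f
f∈image f zero    = x∈p∪q⁺ (inj₁ (x∈⁅x⁆ (f zero)))
f∈image f (suc i) = x∈p∪q⁺ (inj₂ (f∈image (f ∘ suc) i))

∣image∣≤ : ∀ {m n} (f : Fin m → Fin n) → ∣ image f ∣ ≤ m
∣image∣≤ {zero}  {n} f = ≤-reflexive (∣⊥∣≡0 n)
∣image∣≤ {suc m}     f = ≤-trans (∣⁅x⁆∪p∣≤1+∣p∣ (f zero) (image (f ∘ suc))) (s≤s (∣image∣≤ (f ∘ suc)))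

∈N⁻ : ∀ {n} (G : Graph n) {S v} → v ∈ N G S → v ∉ S × ∃ λ u → u ∈ S × adj G u v ≡ true
∈N⁻ G {S} {v} v∈N
  with Equivalence.to T-∧ (Equivalence.from T-≡ (trans (sym (lookup∘tabulate _ v)) ([]=⇒lookup v∈N)))
... | T-v∉S , T-∃u with satisfied (any⁻ _ (allFin _) T-∃u)
... | u , T-u∈S∧uv with Equivalence.to T-∧ T-u∈S∧uv
... | T-u∈S , T-uv =
  (λ v∈S → not-¬ ([]=⇒lookup v∈S) (Equivalence.to T-not-≡ T-v∉S)) ,
  u , lookup⇒[]= u S (Equivalence.to T-≡ T-u∈S) , Equivalence.to T-≡ T-uv

N⊆ : ∀ {n} (G : Graph n) {S T : Subset n} →
     (∀ {u v} → u ∈ S → adj G u v ≡ true → v ∈ S ⊎ v ∈ T) → N G S ⊆ T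
N⊆ G closed v∈N with ∈N⁻ G v∈N
... | v∉S , u , u∈S , uv = [ (λ v∈S → ⊥-elim (v∉S v∈S)) , id ] (closed u∈S uv)

tip : ∀ {n m} {G : Graph n} → Path G m → Fin n
tip P = Path.vert P zero

vertexPath : ∀ {n} {G : Graph n} → Fin n → Path G 0
vertexPath y = record
  { vert     = y Vector.∷ Vector.[]
  ; distinct = λ { {zero} {zero} _ → refl }
  ; edges    = λ ()
  }

extend : ∀ {n m} {G : Graph n} (P : Path G m) (y : Fin n) →
         adj G (tip P) y ≡ true → y ∉ image (Path.vert P) → Path G (suc m)
extend {G = G} P y tip~y y∉P = record { vert = y Vector.∷ vert ; distinct = distinct ; edges = edges }
  where
  open Path P using (vert)
  fresh : ∀ i → vert i ≢ y
  fresh i refl = y∉P (f∈image vert i)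
  distinct : Injective _≡_ _≡_ (y Vector.∷ vert)
  distinct {zero}  {zero}  _  = refl
  distinct {zero}  {suc j} eq = ⊥-elim (fresh j (sym eq))
  distinct {suc i} {zero}  eq = ⊥-elim (fresh i eq)
  distinct {suc i} {suc j} eq = cong suc (Path.distinct P eq)
  edges : ∀ i → adj G ((y Vector.∷ vert) (inject₁ i)) ((y Vector.∷ vert) (suc i)) ≡ true
  edges zero    = trans (Graph.sym G y (tip P)) tip~y
  edges (suc i) = Path.edges P i

module _ {A R : Set} {n : ℕ} (Valid : Subset n → Set) (Good : Subset n → A → Set)
         (Good-mono : ∀ {F F′ y} → F ⊆ F′ → Good F y → Good F′ y) where

  sweep : (∀ y F → Valid F → R ⊎ ∃ λ F′ → F ⊆ F′ × Valid F′ × Good F′ y) →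
          ∀ ys F → Valid F → R ⊎ ∃ λ F′ → F ⊆ F′ × Valid F′ × All (Good F′) ys
  sweep visit []       F valid = inj₂ (F , ⊆-refl , valid , [])
  sweep visit (y ∷ ys) F valid with visit y F valid
  ... | inj₁ r = inj₁ r
  ... | inj₂ (F₁ , F⊆F₁ , valid₁ , good) with sweep visit ys F₁ valid₁
  ...   | inj₁ r = inj₁ r
  ...   | inj₂ (F₂ , F₁⊆F₂ , valid₂ , goods) =
    inj₂ (F₂ , ⊆-trans F⊆F₁ F₁⊆F₂ , valid₂ , Good-mono F₁⊆F₂ good ∷ goods)

module DepthFirstSearch {n : ℕ} (G : Graph n) {k l : ℕ}
                        (expanding : (S : Subset n) → ∣ S ∣ ≡ k → ∣ N G S ∣ ≥ l) where

  record Finished (F : Subset n) {j : ℕ} (stack : Fin j → Fin n) : Set where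
    field
      off-stack : ∀ i → stack i ∉ F
      closed    : ∀ {u v} → u ∈ F → adj G u v ≡ true → v ∈ F ⊎ v ∈ image stack
      small     : ∣ F ∣ < k
  open Finished

  ∣N∣<l⇒∣F∣<k : ∀ F → ∣ F ∣ ≤ k → ∣ N G F ∣ < l → ∣ F ∣ < k
  ∣N∣<l⇒∣F∣<k F ∣F∣≤k ∣NF∣<l = ≤∧≢⇒< ∣F∣≤k (λ ∣F∣≡k → <⇒≱ ∣NF∣<l (expanding F ∣F∣≡k))

  push : ∀ {F j y} {stack : Fin j → Fin n} → Finished F stack → y ∉ F → Finished F (y Vector.∷ stack)
  push fin y∉F = record
    { off-stack = λ { zero → y∉F ; (suc i) → off-stack fin i }
    ; closed    = λ u∈F uv → map₂ (q⊆p∪q _ _) (closed fin u∈F uv)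
    ; small     = small fin
    }

  Settled : ∀ {m} → Path G m → Subset n → Fin n → Set
  Settled P F y = adj G (tip P) y ≡ true → y ∈ F ⊎ y ∈ image (Path.vert P)

  finishTip : ∀ {m F} (P : Path G m) → m < l → Finished F (Path.vert P) → (∀ y → Settled P F y) →
              Finished (⁅ tip P ⁆ ∪ F) (Path.vert P ∘ suc)
  finishTip {m} {F} P m<l fin settled =
    record { off-stack = off-stack′ ; closed = closed′ ; small = small′ }
    where
    open Path P using (vert)
    F′ : Subset n
    F′ = ⁅ tip P ⁆ ∪ F
    F⊆F′ : F ⊆ F′
    F⊆F′ = q⊆p∪q _ F
    pop : ∀ {v} → v ∈ F ⊎ v ∈ image vert → v ∈ F′ ⊎ v ∈ image (vert ∘ suc)
    pop (inj₁ v∈F)     = inj₁ (F⊆F′ v∈F)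
    pop (inj₂ v∈stack) = map₁ (λ v∈tip → x∈p∪q⁺ (inj₁ v∈tip)) (x∈p∪q⁻ _ _ v∈stack)
    closed′ : ∀ {u v} → u ∈ F′ → adj G u v ≡ true → v ∈ F′ ⊎ v ∈ image (vert ∘ suc)
    closed′ {u} {v} u∈F′ uv with x∈p∪q⁻ _ _ u∈F′
    ... | inj₁ u∈tip rewrite x∈⁅y⁆⇒x≡y _ u∈tip = pop (settled v uv)
    ... | inj₂ u∈F = pop (closed fin u∈F uv)
    off-stack′ : ∀ i → vert (suc i) ∉ F′
    off-stack′ i v∈F′ with x∈p∪q⁻ _ _ v∈F′
    ... | inj₁ v∈tip with () ← Path.distinct P (x∈⁅y⁆⇒x≡y _ v∈tip)
    ... | inj₂ v∈F = off-stack fin (suc i) v∈F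
    ∣NF′∣<l : ∣ N G F′ ∣ < l
    ∣NF′∣<l = ≤-<-trans (≤-trans (p⊆q⇒∣p∣≤∣q∣ (N⊆ G closed′)) (∣image∣≤ (vert ∘ suc))) m<l
    small′ : ∣ F′ ∣ < k
    small′ = ∣N∣<l⇒∣F∣<k F′ (≤-trans (∣⁅x⁆∪p∣≤1+∣p∣ (tip P) F) (small fin)) ∣NF′∣<l

  explore : ∀ d {m} → d + m ≡ l → (P : Path G m) → ∀ F → Finished F (Path.vert P) →
            Path G l ⊎ ∃ λ F′ → F ⊆ F′ × tip P ∈ F′ × Finished F′ (Path.vert P ∘ suc)
  visit   : ∀ d {m} → suc d + m ≡ l → (P : Path G m) → ∀ y F → Finished F (Path.vert P) →
            Path G l ⊎ ∃ λ F′ → F ⊆ F′ × Finished F′ (Path.vert P) × Settled P F′ y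

  explore zero        e P F fin = inj₁ (subst (Path G) e P)
  explore (suc d) {m} e P F fin
    with sweep (λ F → Finished F (Path.vert P)) (Settled P) (λ F⊆F′ → map₁ F⊆F′ ∘_)
               (visit d e P) (allFin n) F fin
  ... | inj₁ path = inj₁ path
  ... | inj₂ (F₂ , F⊆F₂ , fin₂ , settled) =
    inj₂ (⁅ tip P ⁆ ∪ F₂ , ⊆-trans F⊆F₂ (q⊆p∪q _ F₂) , x∈p∪q⁺ (inj₁ (x∈⁅x⁆ (tip P))) ,
          finishTip P m<l fin₂ (λ y → All-lookup settled (∈-allFin y)))
    where
    m<l : m < l
    m<l = ≤-trans (s≤s (m≤n+m m d)) (≤-reflexive e)

  visit d e P y F fin with y ∈? F
  ... | yes y∈F = inj₂ (F , ⊆-refl , fin , λ _ → inj₁ y∈F)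
  ... | no y∉F with y ∈? image (Path.vert P)
  ...   | yes y∈P = inj₂ (F , ⊆-refl , fin , λ _ → inj₂ y∈P)
  ...   | no y∉P with adj G (tip P) y in tip~y
  ...     | false = inj₂ (F , ⊆-refl , fin , λ ())
  ...     | true  = map₂ (λ (F′ , F⊆F′ , y∈F′ , fin′) → F′ , F⊆F′ , fin′ , λ _ → inj₁ y∈F′)
                         (explore d (trans (+-suc d _) e) (extend P y tip~y y∉P) F (push fin y∉F))

  visitRoot : ∀ y F → Finished F Vector.[] →
              Path G l ⊎ ∃ λ F′ → F ⊆ F′ × Finished F′ Vector.[] × y ∈ F′
  visitRoot y F fin with y ∈? F
  ... | yes y∈F = inj₂ (F , ⊆-refl , fin , y∈F)
  ... | no y∉F  = map₂ (λ (F′ , F⊆F′ , y∈F′ , fin′) → F′ , F⊆F′ , fin′ , y∈F′)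
                       (explore l (+-identityʳ l) (vertexPath y) F (push fin y∉F))

  finished⊥ : 0 < k → Finished ⊥ Vector.[]
  finished⊥ 0<k = record
    { off-stack = λ ()
    ; closed    = λ u∈⊥ → ⊥-elim (∉⊥ u∈⊥)
    ; small     = subst (_< k) (sym (∣⊥∣≡0 n)) 0<k
    }

  finishedAll⇒n<k : ∀ {F} → Finished F Vector.[] → (∀ v → v ∈ F) → n < k
  finishedAll⇒n<k {F} fin all = ≤-<-trans n≤∣F∣ (small fin)
    where
    n≤∣F∣ : n ≤ ∣ F ∣
    n≤∣F∣ = subst (_≤ ∣ F ∣) (∣⊤∣≡n n) (p⊆q⇒∣p∣≤∣q∣ {p = ⊤} (λ {v} _ → all v))

  longPath : 0 < k → k < n → Path G l
  longPath 0<k k<n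
    with sweep (λ F → Finished F Vector.[]) (λ F y → y ∈ F) (λ F⊆F′ → F⊆F′)
               visitRoot (allFin n) ⊥ (finished⊥ 0<k)
  ... | inj₁ path = path
  ... | inj₂ (F , _ , fin , all) =
    ⊥-elim (<-asym k<n (finishedAll⇒n<k fin (λ v → All-lookup all (∈-allFin v))))

proposition2p1 : (k l n : ℕ) → NonZero k → NonZero l → (G : Graph n) → k < n →
    ((S : Subset n) → ∣ S ∣ ≡ k → ∣ N G S ∣ ≥ l) →
    Path G l
proposition2p1 k l n k≢0 _ G k<n expanding =
  DepthFirstSearch.longPath G expanding (>-nonZero⁻¹ k {{k≢0}}) k<n
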